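{- For any connected graph $G$ of order at least two, $\beta(G)\leq \gamma_{cI}(G)\leq 2\beta(G)$.
   Context: All graphs are finite and simple. $\beta(G)$ denotes the vertex cover number of $G$ (minimum cardinality of a set of vertices containing at least one endpoint of every edge). A function $f:V(G)\to\{0,1,2\}$ is a covering Italian dominating function (CID function) of $G$ if (i) for every vertex $v$ with $f(v)=0$ we have $\sum_{u\in N(v)} f(u)\geq 2$, where $N(v)$ is the open neighborhood of $v$, and (ii) the set $\{v: f(v)=0\}$ is independent. $\gamma_{cI}(G)$ is the minimum of $\sum_{v}f(v)$ over all CID functions $f$ of $G$. -}

module Defs where

open import Data.Nat using (ℕ; zero; suc; _+_; _≤_)
open import Data.Fin using (Fin; zero; suc; toℕ)
open import Data.Bool using (Bool; true; false; if_then_else_)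
open import Data.Product using (Σ; _×_; ∃-syntax)
open import Data.Sum using (_⊎_)
open import Data.Fin.Subset using (Subset; _∈_; ∣_∣)
open import Relation.Binary.PropositionalEquality using (_≡_)
open import Relation.Nullary using (¬_)

record Graph (n : ℕ) : Set where
  field
    adj   : Fin n → Fin n → Bool
    sym   : ∀ u v → adj u v ≡ adj v u
    irrefl : ∀ v → adj v v ≡ false
open Graph public

Edge : ∀ {n} → Graph n → Fin n → Fin n → Set
Edge G u v = adj G u v ≡ true

data Reachable {n : ℕ} (G : Graph n) : Fin n → Fin n → Set where
  here : ∀ {v} → Reachable G v v
  step : ∀ {u v w} → Edge G u v → Reachable G v w → Reachable G u w

Connected : ∀ {n} → Graph n → Set
Connected G = ∀ u v → Reachable G u v

sumFin : (n : ℕ) → (Fin n → ℕ) → ℕ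
sumFin zero    f = 0
sumFin (suc n) f = f zero + sumFin n (λ i → f (suc i))

IsVertexCover : ∀ {n} → Graph n → Subset n → Set
IsVertexCover G S = ∀ u v → Edge G u v → u ∈ S ⊎ v ∈ S

IsVertexCoverNumber : ∀ {n} → Graph n → ℕ → Set
IsVertexCoverNumber {n} G b =
  (Σ (Subset n) λ S → IsVertexCover G S × ∣ S ∣ ≡ b) ×
  (∀ S → IsVertexCover G S → b ≤ ∣ S ∣)

-- Covering Italian dominating functions, f : V → {0,1,2}
weight : ∀ {n} → (Fin n → Fin 3) → ℕ
weight {n} f = sumFin n (λ v → toℕ (f v))

nbrSum : ∀ {n} → Graph n → (Fin n → Fin 3) → Fin n → ℕ
nbrSum {n} G f v = sumFin n (λ u → if adj G v u then toℕ (f u) else 0)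

IsCID : ∀ {n} → Graph n → (Fin n → Fin 3) → Set
IsCID G f =
  (∀ v → toℕ (f v) ≡ 0 → 2 ≤ nbrSum G f v) ×
  (∀ u v → Edge G u v → ¬ (toℕ (f u) ≡ 0 × toℕ (f v) ≡ 0))

IsCIDNumber : ∀ {n} → Graph n → ℕ → Set
IsCIDNumber {n} G g =
  (Σ (Fin n → Fin 3) λ f → IsCID G f × weight f ≡ g) ×
  (∀ f → IsCID G f → g ≤ weight f)

module Submission where

-- A CID function f has an independent zero set, so its support is a vertex
-- cover of size at most the weight of f: this gives β ≤ γ_cI. Conversely,
-- for a vertex cover S put 2 on S and 0 elsewhere: V ∖ S is independent, and
-- every vertex outside S has a neighbour, necessarily in S, contributing 2.
-- Connectedness with at least two vertices only serves to rule out isolated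
-- vertices, and gives γ_cI ≤ 2β.

open import Defs
open import Data.Nat using (ℕ; zero; suc; _+_; _*_; _≤_; z≤n; s≤s)
open import Data.Nat.Properties using (≤-reflexive; ≤-trans; m≤m+n; m≤n+m; +-suc)
open import Data.Fin using (Fin; zero; suc; toℕ; #_)
open import Data.Fin.Subset using (Subset; _∈_; ∣_∣)
open import Data.Vec using ([]; _∷_; lookup; tabulate)
open import Data.Vec.Properties using (lookup⇒[]=; []=⇒lookup; lookup∘tabulate)
open import Data.Bool using (Bool; true; false; if_then_else_)
open import Data.Product using (_×_; _,_; ∃-syntax)
open import Data.Sum using (inj₁; inj₂)
open import Data.Empty using (⊥-elim)
open import Relation.Nullary using (¬_)
open import Relation.Binary.PropositionalEquality using (_≡_; _≢_; refl; cong; trans; module ≡-Reasoning)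
  renaming (sym to ≡-sym)

≤-sumFin : ∀ n (f : Fin n → ℕ) (i : Fin n) → f i ≤ sumFin n f
≤-sumFin (suc n) f zero    = m≤m+n _ _
≤-sumFin (suc n) f (suc i) = ≤-trans (≤-sumFin n (λ j → f (suc j)) i) (m≤n+m _ _)

≤-nbrSum : ∀ {n} (G : Graph n) (f : Fin n → Fin 3) {v u : Fin n} →
           Edge G v u → toℕ (f u) ≤ nbrSum G f v
≤-nbrSum {n} G f {v} {u} vu = ≤-trans (≤-reflexive (≡-sym neighbourTerm)) (≤-sumFin n _ u)
  where
  neighbourTerm : (if adj G v u then toℕ (f u) else 0) ≡ toℕ (f u)
  neighbourTerm rewrite vu = refl

isNonzero : Fin 3 → Bool
isNonzero zero    = false
isNonzero (suc _) = true

support : ∀ {n} → (Fin n → Fin 3) → Subset n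
support f = tabulate (λ v → isNonzero (f v))

∣support∣≤weight : ∀ n (f : Fin n → Fin 3) → ∣ support f ∣ ≤ weight f
∣support∣≤weight zero    f = z≤n
∣support∣≤weight (suc n) f with f zero
... | zero  = ∣support∣≤weight n (λ i → f (suc i))
... | suc k = s≤s (≤-trans (∣support∣≤weight n (λ i → f (suc i))) (m≤n+m _ (toℕ k)))

suc∈support : ∀ {n} (f : Fin n → Fin 3) {v : Fin n} {k : Fin 2} → f v ≡ suc k → v ∈ support f
suc∈support f {v} fv≡suc = lookup⇒[]= v _ (trans (lookup∘tabulate _ v) (cong isNonzero fv≡suc))

support-isVertexCover : ∀ {n} (G : Graph n) {f : Fin n → Fin 3} →
                        IsCID G f → IsVertexCover G (support f)
support-isVertexCover G {f} (_ , independent) u v uv with f u in fu | f v in fv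
... | zero  | zero  = ⊥-elim (independent u v uv (cong toℕ fu , cong toℕ fv))
... | suc _ | _     = inj₁ (suc∈support f fu)
... | zero  | suc _ = inj₂ (suc∈support f fv)

vertexCoverNumber≤CIDNumber : ∀ {n} (G : Graph n) {b g : ℕ} →
                              IsVertexCoverNumber G b → IsCIDNumber G g → b ≤ g
vertexCoverNumber≤CIDNumber {n} G (_ , minimalCover) ((f , cid , weight≡g) , _) =
  ≤-trans (minimalCover (support f) (support-isVertexCover G cid))
          (≤-trans (∣support∣≤weight n f) (≤-reflexive weight≡g))

NoIsolatedVertex : ∀ {n} → Graph n → Set
NoIsolatedVertex G = ∀ v → ∃[ u ] Edge G v u

firstStep : ∀ {n} (G : Graph n) {v w : Fin n} → Reachable G v w → v ≢ w → ∃[ u ] Edge G v u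
firstStep G here          v≢v = ⊥-elim (v≢v refl)
firstStep G (step vu _) _     = _ , vu

connected⇒noIsolatedVertex : ∀ {n} (G : Graph n) → 2 ≤ n → Connected G → NoIsolatedVertex G
connected⇒noIsolatedVertex {suc (suc n)} G _ connected zero    = firstStep G (connected zero (suc zero)) (λ ())
connected⇒noIsolatedVertex {suc (suc n)} G _ connected (suc v) = firstStep G (connected (suc v) zero) (λ ())
connected⇒noIsolatedVertex {suc zero}    G (s≤s ())

twiceIndicator : ∀ {n} → Subset n → Fin n → Fin 3
twiceIndicator S v = if lookup S v then # 2 else # 0

weight-twiceIndicator : ∀ {n} (S : Subset n) → weight (twiceIndicator S) ≡ 2 * ∣ S ∣
weight-twiceIndicator []          = refl
weight-twiceIndicator (false ∷ S) = weight-twiceIndicator S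
weight-twiceIndicator (true ∷ S)  = begin
  2 + weight (twiceIndicator S) ≡⟨ cong (2 +_) (weight-twiceIndicator S) ⟩
  2 + 2 * ∣ S ∣                 ≡⟨ cong suc (≡-sym (+-suc ∣ S ∣ (∣ S ∣ + 0))) ⟩
  2 * suc ∣ S ∣                 ∎
  where open ≡-Reasoning

∈⇒twiceIndicator≡2 : ∀ {n} {S : Subset n} {v : Fin n} → v ∈ S → toℕ (twiceIndicator S v) ≡ 2
∈⇒twiceIndicator≡2 v∈S rewrite []=⇒lookup v∈S = refl

∈⇒twiceIndicator≢0 : ∀ {n} {S : Subset n} {v : Fin n} → v ∈ S → toℕ (twiceIndicator S v) ≢ 0
∈⇒twiceIndicator≢0 v∈S ≡0 with () ← trans (≡-sym (∈⇒twiceIndicator≡2 v∈S)) ≡0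

twiceIndicator-isCID : ∀ {n} (G : Graph n) → NoIsolatedVertex G →
                       {S : Subset n} → IsVertexCover G S → IsCID G (twiceIndicator S)
twiceIndicator-isCID G noIsolated {S} cover = dominated , independent
  where
  dominated : ∀ v → toℕ (twiceIndicator S v) ≡ 0 → 2 ≤ nbrSum G (twiceIndicator S) v
  dominated v ≡0 with noIsolated v
  ... | u , vu with cover v u vu
  ...   | inj₁ v∈S = ⊥-elim (∈⇒twiceIndicator≢0 v∈S ≡0)
  ...   | inj₂ u∈S = ≤-trans (≤-reflexive (≡-sym (∈⇒twiceIndicator≡2 u∈S)))
                             (≤-nbrSum G (twiceIndicator S) vu)

  independent : ∀ u v → Edge G u v →
                ¬ (toℕ (twiceIndicator S u) ≡ 0 × toℕ (twiceIndicator S v) ≡ 0)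
  independent u v uv (u≡0 , v≡0) with cover u v uv
  ... | inj₁ u∈S = ∈⇒twiceIndicator≢0 u∈S u≡0
  ... | inj₂ v∈S = ∈⇒twiceIndicator≢0 v∈S v≡0

CIDNumber≤2*vertexCoverNumber : ∀ {n} (G : Graph n) → NoIsolatedVertex G → {b g : ℕ} →
                                IsVertexCoverNumber G b → IsCIDNumber G g → g ≤ 2 * b
CIDNumber≤2*vertexCoverNumber G noIsolated ((S , cover , ∣S∣≡b) , _) (_ , minimalCID) =
  ≤-trans (minimalCID (twiceIndicator S) (twiceIndicator-isCID G noIsolated cover))
          (≤-reflexive (trans (weight-twiceIndicator S) (cong (2 *_) ∣S∣≡b)))

mainTheorem2 : ∀ {n : ℕ} (G : Graph n) → 2 ≤ n → Connected G →
    ∀ (b g : ℕ) → IsVertexCoverNumber G b → IsCIDNumber G g →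
    b ≤ g × g ≤ 2 * b
mainTheorem2 G 2≤n connected b g isβ isγ =
  vertexCoverNumber≤CIDNumber G isβ isγ ,
  CIDNumber≤2*vertexCoverNumber G (connected⇒noIsolatedVertex G 2≤n connected) isβ isγ
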